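{- Let $k \ge 2$ be an even integer and let $D$ be a strongly connected $k$-quasi-transitive digraph. If $v \in V(D)$ satisfies $\Delta^+_D \ge d^+(v) > \Delta^+_D - k$, then $v$ is a $(k+1)$-king of $D$.
   Context: All digraphs are finite, without loops and without multiple arcs in the same direction; paths are directed. $d(u,v)$ is the length of a shortest directed $uv$-path ($d(v,v)=0$). A vertex $v$ is an $r$-king of $D$ if $d(v,u) \le r$ for every $u \in V(D)$. $d^+(x)$ is the out-degree of $x$ and $\Delta^+_D$ is the maximum out-degree in $D$. $D$ is $k$-quasi-transitive if for every directed path $(v_0, \dots, v_k)$ of length $k$, $(v_0,v_k) \in A(D)$ or $(v_k,v_0) \in A(D)$. -}

module Defs where

open import Data.Nat using (ℕ; zero; suc; _+_; _≤_; _<_; _∸_; _⊔_)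
open import Data.Fin using (Fin)
open import Data.List using (List; []; _∷_; length; filter; map; foldr)
open import Data.List.Relation.Unary.AllPairs using (AllPairs)
open import Data.List.Relation.Unary.Linked using (Linked)
open import Data.List.Relation.Unary.Any using (Any)
open import Data.Product using (Σ; _×_; ∃; ∃-syntax)
open import Data.Sum using (_⊎_)
open import Data.Maybe using (Maybe; just)
open import Data.Fin.Base using ()
open import Data.List.Base using (head; last; allFin)
open import Relation.Nullary using (¬_; Dec)
open import Relation.Unary using (Decidable)
open import Relation.Binary.PropositionalEquality using (_≡_; _≢_)

record Digraph (n : ℕ) : Set₁ where
  field
    Arc       : Fin n → Fin n → Set
    arc?      : (x y : Fin n) → Dec (Arc x y)
    loopless  : (x : Fin n) → ¬ Arc x x
open Digraph public

module _ {n : ℕ} (D : Digraph n) where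

  record Path : Set where
    field
      verts    : List (Fin n)
      distinct : AllPairs _≢_ verts
      arcs     : Linked (Arc D) verts
  open Path public

  pathLength : Path → ℕ
  pathLength p = length (verts p) ∸ 1

  IsPathFromTo : Path → Fin n → Fin n → Set
  IsPathFromTo p u v = (head (verts p) ≡ just u) × (last (verts p) ≡ just v)

  DistLe : Fin n → Fin n → ℕ → Set
  DistLe u v r = Σ Path λ p → IsPathFromTo p u v × (pathLength p ≤ r)

  IsKing : ℕ → Fin n → Set
  IsKing r v = (u : Fin n) → DistLe v u r

  StronglyConnected : Set
  StronglyConnected = (u v : Fin n) → Σ Path λ p → IsPathFromTo p u v

  QuasiTransitive : ℕ → Set
  QuasiTransitive k = (p : Path) (u v : Fin n) → IsPathFromTo p u v →
                      pathLength p ≡ k → Arc D u v ⊎ Arc D v u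

  outDeg : Fin n → ℕ
  outDeg x = length (filter (λ y → arc? D x y) (allFin n))

  maxOutDeg : ℕ
  maxOutDeg = foldr (λ x m → outDeg x ⊔ m) 0 (allFin n)

-- Let v = x₀ → x₁ → ⋯ → x_b = u be a path with b ≥ k + 2 and put w = x_{k+2}. Unless the path
-- can be shortened by an arc x₀ → x_j (j ≥ 2), an arc x_i → w (i ≤ k) or a path x₀ → z → w,
-- quasi-transitivity along x₀ ⋯ x_k closes the cycle C = x₀ ⋯ x_k x₀ of odd length k + 1, and
-- along x₂ ⋯ w it gives w → x₂. Along w followed by k consecutive vertices of C it turns an arc
-- w → c into an arc from w to the vertex two steps before c on C; since k + 1 is odd, w then
-- reaches every vertex of C by an arc. Along w, x₃, …, x_k, x₀, y it gives w → y for every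
-- out-neighbour y ≠ x₁ of x₀. So N⁺(w) contains N⁺(x₀) together with the k vertices
-- x₀, x₂, …, x_k outside it, whence d⁺(w) ≥ d⁺(v) + k > Δ⁺, which is impossible. Hence every
-- v-u path can be shortened until its length is at most k + 1.
module Submission where

open import Defs
open import Data.Nat using (ℕ; zero; suc; _+_; _*_; _≤_; _<_; _∸_; _⊔_; _%_; _/_; z≤n; s≤s; z<s; s<s; _≤?_; NonZero)
open import Data.Nat.Properties
  using ( ≤-refl; ≤-trans; ≤-reflexive; ≤-pred; <⇒≤; <⇒≱; ≰⇒>; <-cmp; <-≤-trans; ≤-<-trans; n≮0; 1+n≰n
        ; n≤1+n; m≤n⇒m≤1+n; m≤m+n; m≤n+m; m<m+n; m≤n⇒m<n∨m≡n; m≤n⇒∃[o]m+o≡n; m≤m⊔n; m≤n⊔m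
        ; +-suc; +-comm; +-assoc; +-identityʳ; +-cancelˡ-≡; +-monoˡ-≤; +-monoˡ-<; m+[n∸m]≡n; m∸n+n≡m
        ; anyUpTo?; module ≤-Reasoning )
open import Data.Nat.DivMod
  using (%-distribˡ-+; m%n%n≡m%n; m≡m%n+[m/n]*n; m≤n⇒m%n≡m; m%n<n; n%n≡0; [m+n]%n≡m%n; [m+kn]%n≡m%n)
open import Data.Nat.Divisibility using (_∣_; ∣m+n∣m⇒∣n; n∣m*n; >⇒∤)
open import Data.Nat.Induction using (<-rec)
open import Data.Nat.Tactic.RingSolver using (solve-∀)
open import Data.Fin using (Fin; _≟_)
open import Data.Fin.Properties using (any?)
open import Data.List using (List; []; _∷_; length; applyUpTo; filter; foldr; _++_; head; last; allFin)
open import Data.List.Properties using (length-applyUpTo; length-++)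
open import Data.List.Relation.Unary.All as All using (All; []; _∷_)
open import Data.List.Relation.Unary.All.Properties using (¬Any⇒All¬; applyUpTo⁺₁)
open import Data.List.Relation.Unary.AllPairs using (AllPairs; []; _∷_)
open import Data.List.Relation.Unary.Any using (here; there)
open import Data.List.Relation.Unary.Linked using (Linked; [-]; _∷_)
open import Data.List.Relation.Unary.Unique.Propositional using (Unique)
import Data.List.Relation.Unary.Unique.Propositional.Properties as Unique
open import Data.List.Relation.Binary.Subset.Propositional using (_⊆_)
open import Data.List.Membership.Propositional using (_∈_)
open import Data.List.Membership.Propositional.Properties
  using (∈-∃++; ∈-++⁻; ∈-++⁺ˡ; ∈-++⁺ʳ; ∈-filter⁺; ∈-filter⁻; ∈-allFin)
import Data.List.Membership.DecPropositional as DecMembership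
open import Data.Maybe using (just)
open import Data.Product using (Σ; _×_; _,_; proj₁; proj₂)
open import Data.Sum using (_⊎_; inj₁; inj₂)
open import Data.Empty using (⊥-elim)
open import Function using (_∘_)
open import Relation.Nullary using (¬_; yes; no)
open import Relation.Nullary.Decidable using (_×-dec_)
open import Relation.Binary.Definitions using (tri<; tri≈; tri>)
open import Relation.Binary.PropositionalEquality
  using (_≡_; _≢_; refl; sym; trans; cong; subst; subst₂; module ≡-Reasoning)

_◃_ : ∀ {A : Set} → A → (ℕ → A) → ℕ → A
(a ◃ f) zero    = a
(a ◃ f) (suc t) = f t

snoc : ∀ {A : Set} → (ℕ → A) → ℕ → A → ℕ → A
snoc f m a t with t ≤? m
... | yes _ = f t
... | no  _ = a

snoc-≤ : ∀ {A : Set} (f : ℕ → A) {m} a {t} → t ≤ m → snoc f m a t ≡ f t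
snoc-≤ f {m} a {t} t≤m with t ≤? m
... | yes _   = refl
... | no  t≰m = ⊥-elim (t≰m t≤m)

snoc-suc : ∀ {A : Set} (f : ℕ → A) m a → snoc f m a (suc m) ≡ a
snoc-suc f m a with suc m ≤? m
... | yes 1+m≤m = ⊥-elim (1+n≰n 1+m≤m)
... | no  _     = refl

i<j≤b⇒i+[1+b∸j]≤b : ∀ {i j b} → i < j → j ≤ b → i + suc (b ∸ j) ≤ b
i<j≤b⇒i+[1+b∸j]≤b {i} {j} {b} i<j j≤b = begin
  i + suc (b ∸ j)  ≡⟨ +-suc i (b ∸ j) ⟩
  suc i + (b ∸ j)  ≤⟨ +-monoˡ-≤ (b ∸ j) i<j ⟩
  j + (b ∸ j)      ≡⟨ m+[n∸m]≡n j≤b ⟩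
  b                ∎
  where open ≤-Reasoning

[1+m]%n≡[1+m%n]%n : ∀ m n .{{_ : NonZero n}} → suc m % n ≡ suc (m % n) % n
[1+m]%n≡[1+m%n]%n m n = begin
  (1 + m) % n              ≡⟨ %-distribˡ-+ 1 m n ⟩
  (1 % n + m % n) % n      ≡⟨ cong (λ r → (1 % n + r) % n) (m%n%n≡m%n m n) ⟨
  (1 % n + m % n % n) % n  ≡⟨ %-distribˡ-+ 1 (m % n) n ⟨
  (1 + m % n) % n          ∎
  where open ≡-Reasoning

[d+m]%n≡m%n⇒n∣d : ∀ d m n .{{_ : NonZero n}} → (d + m) % n ≡ m % n → n ∣ d
[d+m]%n≡m%n⇒n∣d d m n eq =
  ∣m+n∣m⇒∣n (subst (n ∣_) (sym quotients) (n∣m*n ((d + m) / n))) (n∣m*n (m / n))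
  where
    open ≡-Reasoning
    quotients : m / n * n + d ≡ (d + m) / n * n
    quotients = +-cancelˡ-≡ (m % n) _ _ (begin
      m % n + (m / n * n + d)        ≡⟨ +-assoc (m % n) (m / n * n) d ⟨
      m % n + m / n * n + d          ≡⟨ cong (_+ d) (m≡m%n+[m/n]*n m n) ⟨
      m + d                          ≡⟨ +-comm m d ⟩
      d + m                          ≡⟨ m≡m%n+[m/n]*n (d + m) n ⟩
      (d + m) % n + (d + m) / n * n  ≡⟨ cong (_+ (d + m) / n * n) eq ⟩
      m % n + (d + m) / n * n        ∎)

window-%-injective : ∀ {i j} s n .{{_ : NonZero n}} → i < j → j < n → (i + s) % n ≢ (j + s) % n
window-%-injective {i} s n i<j j<n eq with m≤n⇒∃[o]m+o≡n i<j
... | o , refl =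
  >⇒∤ (≤-trans (s≤s (s≤s (m≤n+m o i))) j<n)
      ([d+m]%n≡m%n⇒n∣d (suc o) (i + s) n (trans (cong (_% n) shift) (sym eq)))
  where
    shift : suc o + (i + s) ≡ suc i + o + s
    shift = cong suc (trans (sym (+-assoc o i s)) (cong (_+ s) (+-comm o i)))

-- (q + 1)(k − 1) ≡ 1 modulo k + 1 for k = 2q + 2.
rotation : ∀ q s → suc q * suc (q + q) + s ≡ suc s + q * suc (suc (suc (q + q)))
rotation = solve-∀

unique-⊆⇒length≤ : ∀ {A : Set} {xs ys : List A} → Unique xs → xs ⊆ ys → length xs ≤ length ys
unique-⊆⇒length≤ {xs = []}     _            _       = z≤n
unique-⊆⇒length≤ {xs = x ∷ xs} (x∉xs ∷ uxs) x∷xs⊆ys with ∈-∃++ (x∷xs⊆ys (here refl))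
... | ys₁ , ys₂ , refl = begin
  suc (length xs)                ≤⟨ s≤s (unique-⊆⇒length≤ uxs xs⊆ys₁++ys₂) ⟩
  suc (length (ys₁ ++ ys₂))      ≡⟨ cong suc (length-++ ys₁) ⟩
  suc (length ys₁ + length ys₂)  ≡⟨ +-suc (length ys₁) (length ys₂) ⟨
  length ys₁ + suc (length ys₂)  ≡⟨ length-++ ys₁ ⟨
  length (ys₁ ++ x ∷ ys₂)        ∎
  where
    open ≤-Reasoning
    xs⊆ys₁++ys₂ : xs ⊆ ys₁ ++ ys₂
    xs⊆ys₁++ys₂ {z} z∈xs with ∈-++⁻ ys₁ (x∷xs⊆ys (there z∈xs))
    ... | inj₁ z∈ys₁         = ∈-++⁺ˡ z∈ys₁
    ... | inj₂ (here refl)   = ⊥-elim (All.lookup x∉xs z∈xs refl)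
    ... | inj₂ (there z∈ys₂) = ∈-++⁺ʳ ys₁ z∈ys₂

module _ {n : ℕ} (D : Digraph n) where

  open DecMembership (_≟_ {n}) using (_∈?_)

  -- The path x₀ → x₁ → ⋯ → x_m; the values of x beyond m play no role.
  record IsPathSeq (x : ℕ → Fin n) (m : ℕ) : Set where
    field
      arc       : ∀ {j} → j < m → Arc D (x j) (x (suc j))
      injective : ∀ {i j} → i < j → j ≤ m → x i ≢ x j

    index-unique : ∀ {i j} → i ≤ m → j ≤ m → x i ≡ x j → i ≡ j
    index-unique {i} {j} i≤m j≤m xᵢ≡xⱼ with <-cmp i j
    ... | tri< i<j _ _ = ⊥-elim (injective i<j j≤m xᵢ≡xⱼ)
    ... | tri≈ _ i≡j _ = i≡j
    ... | tri> _ _ j<i = ⊥-elim (injective j<i i≤m (sym xᵢ≡xⱼ))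

  open IsPathSeq public

  module _ {x : ℕ → Fin n} {m : ℕ} (π : IsPathSeq x m) where

    restrict : ∀ {j} → j ≤ m → IsPathSeq x j
    restrict j≤m = record
      { arc       = λ i<j → arc π (≤-trans i<j j≤m)
      ; injective = λ i<j j≤ → injective π i<j (≤-trans j≤ j≤m) }

    prepend : ∀ {w} → Arc D w (x 0) → (∀ {t} → t ≤ m → w ≢ x t) → IsPathSeq (w ◃ x) (suc m)
    prepend {w} w⟶x₀ w∉x = record { arc = arc′ ; injective = injective′ }
      where
        arc′ : ∀ {j} → j < suc m → Arc D ((w ◃ x) j) ((w ◃ x) (suc j))
        arc′ {zero}  _         = w⟶x₀
        arc′ {suc j} (s≤s j<m) = arc π j<m
        injective′ : ∀ {i j} → i < j → j ≤ suc m → (w ◃ x) i ≢ (w ◃ x) j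
        injective′ {zero}  {suc j} _         (s≤s j≤m) = w∉x j≤m
        injective′ {suc i} {suc j} (s≤s i<j) (s≤s j≤m) = injective π i<j j≤m

    append : ∀ {a} → Arc D (x m) a → (∀ {t} → t ≤ m → x t ≢ a) → IsPathSeq (snoc x m a) (suc m)
    append {a} xₘ⟶a x∌a = record { arc = arc′ ; injective = injective′ }
      where
        arc′ : ∀ {j} → j < suc m → Arc D (snoc x m a j) (snoc x m a (suc j))
        arc′ {j} (s≤s j≤m) with m≤n⇒m<n∨m≡n j≤m
        ... | inj₁ j<m  rewrite snoc-≤ x a j≤m | snoc-≤ x a j<m = arc π j<m
        ... | inj₂ refl rewrite snoc-≤ x a (≤-refl {m}) | snoc-suc x m a = xₘ⟶a
        injective′ : ∀ {i j} → i < j → j ≤ suc m → snoc x m a i ≢ snoc x m a j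
        injective′ {i} {j} i<j j≤1+m with m≤n⇒m<n∨m≡n j≤1+m
        ... | inj₁ (s≤s j≤m) rewrite snoc-≤ x a j≤m | snoc-≤ x a (≤-trans (<⇒≤ i<j) j≤m) =
              injective π i<j j≤m
        ... | inj₂ refl      rewrite snoc-≤ x a (≤-pred i<j) | snoc-suc x m a = x∌a (≤-pred i<j)

  shift : ∀ {x m} i → IsPathSeq x (m + i) → IsPathSeq (λ t → x (t + i)) m
  shift i π = record
    { arc       = λ j<m → arc π (+-monoˡ-< i j<m)
    ; injective = λ j<l l≤m → injective π (+-monoˡ-< i j<l) (+-monoˡ-≤ i l≤m) }

  suffix : ∀ {x m i} → i ≤ m → IsPathSeq x m → IsPathSeq (λ t → x (t + i)) (m ∸ i)
  suffix {x} {m} {i} i≤m π = shift i (subst (IsPathSeq x) (sym (m∸n+n≡m i≤m)) π)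

  linked-applyUpTo : ∀ {x} m → (∀ {j} → j < m → Arc D (x j) (x (suc j))) →
                     Linked (Arc D) (applyUpTo x (suc m))
  linked-applyUpTo zero    _   = [-]
  linked-applyUpTo (suc m) arc = arc z<s ∷ linked-applyUpTo m (arc ∘ s<s)

  last-applyUpTo : ∀ (x : ℕ → Fin n) m → last (applyUpTo x (suc m)) ≡ just (x m)
  last-applyUpTo x zero    = refl
  last-applyUpTo x (suc m) = last-applyUpTo (x ∘ suc) m

  toPath : ∀ {x m} → IsPathSeq x m →
           Σ (Path D) λ P → IsPathFromTo D P (x 0) (x m) × pathLength D P ≡ m
  toPath {x} {m} π =
    record { verts    = applyUpTo x (suc m)
           ; distinct = Unique.applyUpTo⁺₁ x (suc m) λ i<j j<1+m → injective π i<j (≤-pred j<1+m)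
           ; arcs     = linked-applyUpTo m (arc π) } ,
    (refl , last-applyUpTo x m) ,
    cong (_∸ 1) (length-applyUpTo x (suc m))

  quasiTransitiveSeq : ∀ {k x} → QuasiTransitive D k → IsPathSeq x k →
                       Arc D (x 0) (x k) ⊎ Arc D (x k) (x 0)
  quasiTransitiveSeq qt π with toPath π
  ... | P , ends , len = qt P _ _ ends len

  enumerate : ∀ {a b} xs → AllPairs _≢_ xs → Linked (Arc D) xs → head xs ≡ just a → last xs ≡ just b →
              Σ (ℕ → Fin n) λ x → IsPathSeq x (length xs ∸ 1) × x 0 ≡ a × x (length xs ∸ 1) ≡ b ×
                                  (∀ {t} → t ≤ length xs ∸ 1 → x t ∈ xs)
  enumerate (a ∷ []) _ _ refl refl =
    (λ _ → a) ,
    record { arc = λ () ; injective = λ i<j j≤0 _ → n≮0 (<-≤-trans i<j j≤0) } ,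
    refl , refl , λ _ → here refl
  enumerate (a ∷ c ∷ ys) (a∉ ∷ d) (a⟶c ∷ l) refl lt with enumerate (c ∷ ys) d l refl lt
  ... | x , π , refl , xₘ≡b , x∈ =
    a ◃ x ,
    prepend π a⟶c (λ t≤m → All.lookup a∉ (x∈ t≤m)) ,
    refl , xₘ≡b ,
    λ { {zero} _ → here refl ; {suc t} (s≤s t≤m) → there (x∈ t≤m) }

  fromPath : ∀ {a b} (P : Path D) → IsPathFromTo D P a b →
             Σ (ℕ → Fin n) λ x → IsPathSeq x (pathLength D P) × x 0 ≡ a × x (pathLength D P) ≡ b
  fromPath P (hd , lt) with enumerate (verts P) (distinct P) (arcs P) hd lt
  ... | x , π , x₀≡a , xₘ≡b , _ = x , π , x₀≡a , xₘ≡b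

  data Walk : Fin n → Fin n → ℕ → Set where
    []  : ∀ {a} → Walk a a 0
    _∷_ : ∀ {a b c m} → Arc D a b → Walk b c m → Walk a c (suc m)

  infixr 5 _∷_ _++ʷ_

  _++ʷ_ : ∀ {a b c l m} → Walk a b l → Walk b c m → Walk a c (l + m)
  []      ++ʷ w′ = w′
  (e ∷ w) ++ʷ w′ = e ∷ (w ++ʷ w′)

  walkAlong : ∀ x m → (∀ {j} → j < m → Arc D (x j) (x (suc j))) → Walk (x 0) (x m) m
  walkAlong x zero    _   = []
  walkAlong x (suc m) arc = arc z<s ∷ walkAlong (x ∘ suc) m (arc ∘ s<s)

  module _ {x : ℕ → Fin n} {b : ℕ} (π : IsPathSeq x b) where

    prefixWalk : ∀ {i} → i ≤ b → Walk (x 0) (x i) i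
    prefixWalk {i} i≤b = walkAlong x i (arc (restrict π i≤b))

    suffixWalk : ∀ {i} → i ≤ b → Walk (x i) (x b) (b ∸ i)
    suffixWalk {i} i≤b = subst (λ v → Walk (x i) v (b ∸ i)) (cong x (m∸n+n≡m i≤b))
                           (walkAlong (λ t → x (t + i)) (b ∸ i) (arc (suffix i≤b π)))

  distLe-weaken : ∀ {a b l m} → l ≤ m → DistLe D a b l → DistLe D a b m
  distLe-weaken l≤m (P , ends , len) = P , ends , ≤-trans len l≤m

  suffixDistLe : ∀ {a b} xs → AllPairs _≢_ xs → Linked (Arc D) xs → last xs ≡ just b → a ∈ xs →
                 DistLe D a b (length xs ∸ 1)
  suffixDistLe (y ∷ ys) d l lt (here refl) =
    record { verts = y ∷ ys ; distinct = d ; arcs = l } , (refl , lt) , ≤-refl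
  suffixDistLe (y ∷ z ∷ zs) (_ ∷ d) (_ ∷ l) lt (there a∈) =
    distLe-weaken (n≤1+n _) (suffixDistLe (z ∷ zs) d l lt a∈)

  prependDistLe : ∀ {a c b m} → Arc D a c → (P : Path D) → IsPathFromTo D P c b →
                  pathLength D P ≤ m → ¬ a ∈ verts P → DistLe D a b (suc m)
  prependDistLe {a} a⟶c record { verts = c ∷ xs ; distinct = d ; arcs = l } (refl , lt) len a∉ =
    record { verts = a ∷ c ∷ xs ; distinct = ¬Any⇒All¬ _ a∉ ∷ d ; arcs = a⟶c ∷ l } ,
    (refl , lt) , s≤s len

  walk⇒distLe : ∀ {a b m} → Walk a b m → DistLe D a b m
  walk⇒distLe {a} [] =
    record { verts = a ∷ [] ; distinct = [] ∷ [] ; arcs = [-] } , (refl , refl) , z≤n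
  walk⇒distLe {a} (a⟶c ∷ w) with walk⇒distLe w
  ... | P , (hd , lt) , len with a ∈? verts P
  ...   | yes a∈P = distLe-weaken (m≤n⇒m≤1+n len) (suffixDistLe (verts P) (distinct P) (arcs P) lt a∈P)
  ...   | no  a∉P = prependDistLe a⟶c P (hd , lt) len a∉P

  outDeg≤maxOutDeg : ∀ x → outDeg D x ≤ maxOutDeg D
  outDeg≤maxOutDeg x = go (allFin n) (∈-allFin x)
    where
      go : ∀ ys → x ∈ ys → outDeg D x ≤ foldr (λ y m → outDeg D y ⊔ m) 0 ys
      go (y ∷ ys) (here refl)  = m≤m⊔n (outDeg D x) _
      go (y ∷ ys) (there x∈ys) = ≤-trans (go ys x∈ys) (m≤n⊔m (outDeg D y) _)

  outDeg-dominated : ∀ {a b} → (∀ {z} → Arc D a z → Arc D b z) →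
                     (E : List (Fin n)) → Unique E → All (λ z → Arc D b z × ¬ Arc D a z) E →
                     outDeg D a + length E ≤ outDeg D b
  outDeg-dominated {a} {b} N⁺a⊆N⁺b E uE E⊆N⁺b∖N⁺a = begin
    outDeg D a + length E  ≡⟨ length-++ N⁺a ⟨
    length (N⁺a ++ E)      ≤⟨ unique-⊆⇒length≤ (Unique.++⁺ uN⁺a uE disjoint) N⁺a++E⊆N⁺b ⟩
    outDeg D b             ∎
    where
      open ≤-Reasoning
      N⁺a = filter (arc? D a) (allFin n)
      uN⁺a : Unique N⁺a
      uN⁺a = Unique.filter⁺ (arc? D a) (Unique.allFin⁺ n)
      a⟶ : ∀ {z} → z ∈ N⁺a → Arc D a z
      a⟶ = proj₂ ∘ ∈-filter⁻ (arc? D a) {xs = allFin n}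
      disjoint : ∀ {z} → ¬ (z ∈ N⁺a × z ∈ E)
      disjoint (z∈N⁺a , z∈E) = proj₂ (All.lookup E⊆N⁺b∖N⁺a z∈E) (a⟶ z∈N⁺a)
      N⁺a++E⊆N⁺b : N⁺a ++ E ⊆ filter (arc? D b) (allFin n)
      N⁺a++E⊆N⁺b {z} z∈ with ∈-++⁻ N⁺a z∈
      ... | inj₁ z∈N⁺a = ∈-filter⁺ (arc? D b) (∈-allFin z) (N⁺a⊆N⁺b (a⟶ z∈N⁺a))
      ... | inj₂ z∈E   = ∈-filter⁺ (arc? D b) (∈-allFin z) (proj₁ (All.lookup E⊆N⁺b∖N⁺a z∈E))

  record NoShortcut (k : ℕ) (x : ℕ → Fin n) : Set where
    field
      noChord   : ∀ {j} → 2 ≤ j → j ≤ k + 2 → ¬ Arc D (x 0) (x j)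
      noArcInto : ∀ {i} → i ≤ k → ¬ Arc D (x i) (x (k + 2))
      noTwoPath : ∀ {z} → Arc D (x 0) z → ¬ Arc D z (x (k + 2))

  shortcut⊎noShortcut : ∀ {k x b} → 0 < k → IsPathSeq x b → k + 2 ≤ b →
                        (Σ ℕ λ m → m < b × Walk (x 0) (x b) m) ⊎ NoShortcut k x
  shortcut⊎noShortcut {k} {x} {b} 0<k π k+2≤b
    with anyUpTo? (λ j → 2 ≤? j ×-dec arc? D (x 0) (x j)) (suc (k + 2))
  ... | yes (j , s≤s j≤k+2 , 2≤j , x₀⟶xⱼ) =
        inj₁ (_ , i<j≤b⇒i+[1+b∸j]≤b 2≤j j≤b , x₀⟶xⱼ ∷ suffixWalk π j≤b)
    where j≤b = ≤-trans j≤k+2 k+2≤b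
  ... | no ¬chord with anyUpTo? (λ i → arc? D (x i) (x (k + 2))) (suc k)
  ...   | yes (i , s≤s i≤k , xᵢ⟶w) =
          inj₁ (_ , i<j≤b⇒i+[1+b∸j]≤b 1+i<k+2 k+2≤b ,
                prefixWalk π (≤-trans i≤k (≤-trans (m≤m+n k 2) k+2≤b)) ++ʷ xᵢ⟶w ∷ suffixWalk π k+2≤b)
    where 1+i<k+2 = ≤-trans (s≤s (s≤s i≤k)) (≤-reflexive (+-comm 2 k))
  ...   | no ¬into with any? (λ z → arc? D (x 0) z ×-dec arc? D z (x (k + 2)))
  ...     | yes (z , x₀⟶z , z⟶w) =
            inj₁ (_ , i<j≤b⇒i+[1+b∸j]≤b (+-monoˡ-< 2 0<k) k+2≤b , x₀⟶z ∷ z⟶w ∷ suffixWalk π k+2≤b)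
  ...     | no ¬twoPath = inj₂ record
            { noChord   = λ 2≤j j≤k+2 x₀⟶xⱼ → ¬chord (_ , s≤s j≤k+2 , 2≤j , x₀⟶xⱼ)
            ; noArcInto = λ i≤k xᵢ⟶w → ¬into (_ , s≤s i≤k , xᵢ⟶w)
            ; noTwoPath = λ x₀⟶z z⟶w → ¬twoPath (_ , x₀⟶z , z⟶w) }

  shortcuts⇒isKing : ∀ {k v} → 0 < k → StronglyConnected D →
                     (∀ {x} → x 0 ≡ v → IsPathSeq x (k + 2) → ¬ NoShortcut k x) →
                     IsKing D (suc k) v
  shortcuts⇒isKing {k} {v} 0<k sc shortcutFree⇒⊥ u with sc v u
  ... | P , ends =
    <-rec (λ b → DistLe D v u b → DistLe D v u (suc k)) shorten (pathLength D P) (P , ends , ≤-refl)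
    where
      k+2≤ : ∀ {ℓ} → ¬ ℓ ≤ suc k → k + 2 ≤ ℓ
      k+2≤ ℓ≰1+k = ≤-trans (≤-reflexive (+-comm k 2)) (≰⇒> ℓ≰1+k)

      shorten : ∀ b → (∀ {m} → m < b → DistLe D v u m → DistLe D v u (suc k)) →
                DistLe D v u b → DistLe D v u (suc k)
      shorten b shorter (P , ends , ℓ≤b) with pathLength D P ≤? suc k
      ... | yes ℓ≤1+k = P , ends , ℓ≤1+k
      ... | no  ℓ≰1+k with fromPath P ends
      ...   | x , π , x₀≡v , xℓ≡u with shortcut⊎noShortcut 0<k π (k+2≤ ℓ≰1+k)
      ...     | inj₁ (m , m<ℓ , walk) =
                shorter (<-≤-trans m<ℓ ℓ≤b) (walk⇒distLe (subst₂ (λ a c → Walk a c m) x₀≡v xℓ≡u walk))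
      ...     | inj₂ noShortcut = ⊥-elim (shortcutFree⇒⊥ x₀≡v (restrict π (k+2≤ ℓ≰1+k)) noShortcut)

  module Domination (q : ℕ) where

    p k K : ℕ
    p = suc (q + q)
    k = suc p
    K = suc k

    module _ (qt : QuasiTransitive D k) {x : ℕ → Fin n} (π : IsPathSeq x (k + 2))
             (noShortcut : NoShortcut k x) where

      open NoShortcut noShortcut

      w : Fin n
      w = x (k + 2)

      2≤k : 2 ≤ k
      2≤k = s≤s (s≤s z≤n)

      k<k+2 : k < k + 2
      k<k+2 = m<m+n k z<s

      k≤k+2 : k ≤ k + 2
      k≤k+2 = <⇒≤ k<k+2

      xᵢ≢w : ∀ {i} → i ≤ k → x i ≢ w
      xᵢ≢w i≤k = injective π (≤-<-trans i≤k k<k+2) ≤-refl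

      closingArc : Arc D (x k) (x 0)
      closingArc with quasiTransitiveSeq qt (restrict π k≤k+2)
      ... | inj₁ x₀⟶xₖ = ⊥-elim (noChord 2≤k k≤k+2 x₀⟶xₖ)
      ... | inj₂ xₖ⟶x₀ = xₖ⟶x₀

      w⟶x₂ : Arc D w (x 2)
      w⟶x₂ with quasiTransitiveSeq qt (shift 2 π)
      ... | inj₁ x₂⟶w = ⊥-elim (noArcInto 2≤k x₂⟶w)
      ... | inj₂ w⟶x₂ = w⟶x₂

      cyc : ℕ → Fin n
      cyc j = x (j % K)

      j%K≤k : ∀ j → j % K ≤ k
      j%K≤k j = ≤-pred (m%n<n j K)

      cyc-≤ : ∀ {j} → j ≤ k → cyc j ≡ x j
      cyc-≤ j≤k = cong x (m≤n⇒m%n≡m j≤k)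

      w≢cyc : ∀ j → w ≢ cyc j
      w≢cyc j = xᵢ≢w (j%K≤k j) ∘ sym

      cyc-arc : ∀ j → Arc D (cyc j) (cyc (suc j))
      cyc-arc j with m≤n⇒m<n∨m≡n (j%K≤k j)
      ... | inj₁ j%K<k = subst (Arc D (cyc j)) (cong x (sym 1+j%K)) (arc π (≤-trans j%K<k k≤k+2))
        where
          1+j%K : suc j % K ≡ suc (j % K)
          1+j%K = trans ([1+m]%n≡[1+m%n]%n j K) (m≤n⇒m%n≡m j%K<k)
      ... | inj₂ j%K≡k = subst₂ (Arc D) (cong x (sym j%K≡k)) (cong x (sym 1+j%K)) closingArc
        where
          1+j%K : suc j % K ≡ 0
          1+j%K = trans ([1+m]%n≡[1+m%n]%n j K) (trans (cong (λ r → suc r % K) j%K≡k) (n%n≡0 K))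

      cyc-window : ∀ s {m} → m ≤ k → IsPathSeq (λ t → cyc (t + s)) m
      cyc-window s {m} m≤k = record { arc = λ {j} _ → cyc-arc (j + s) ; injective = window-injective }
        where
          window-injective : ∀ {i j} → i < j → j ≤ m → cyc (i + s) ≢ cyc (j + s)
          window-injective {i} {j} i<j j≤m cycᵢ≡cycⱼ =
            window-%-injective s K i<j (s≤s (≤-trans j≤m m≤k))
              (index-unique π (≤-trans (j%K≤k (i + s)) k≤k+2) (≤-trans (j%K≤k (j + s)) k≤k+2) cycᵢ≡cycⱼ)

      -- Quasi-transitivity along w, cyc s, …, cyc (s + k − 1).
      w⟶cyc⇒w⟶cyc[p+] : ∀ s → Arc D w (cyc s) → Arc D w (cyc (p + s))
      w⟶cyc⇒w⟶cyc[p+] s w⟶cycₛ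
        with quasiTransitiveSeq qt (prepend (cyc-window s (n≤1+n p)) w⟶cycₛ (λ {t} _ → w≢cyc (t + s)))
      ... | inj₁ w⟶cyc = w⟶cyc
      ... | inj₂ cyc⟶w = ⊥-elim (noArcInto (j%K≤k (p + s)) cyc⟶w)

      w⟶cyc⇒w⟶cyc[tp+] : ∀ t s → Arc D w (cyc s) → Arc D w (cyc (t * p + s))
      w⟶cyc⇒w⟶cyc[tp+] zero    s w⟶cycₛ = w⟶cycₛ
      w⟶cyc⇒w⟶cyc[tp+] (suc t) s w⟶cycₛ =
        subst (λ i → Arc D w (cyc i)) (sym (+-assoc p (t * p) s))
          (w⟶cyc⇒w⟶cyc[p+] (t * p + s) (w⟶cyc⇒w⟶cyc[tp+] t s w⟶cycₛ))

      w⟶cyc⇒w⟶cyc[1+] : ∀ s → Arc D w (cyc s) → Arc D w (cyc (suc s))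
      w⟶cyc⇒w⟶cyc[1+] s w⟶cycₛ =
        subst (λ i → Arc D w (x i)) (trans (cong (_% K) (rotation q s)) ([m+kn]%n≡m%n (suc s) q K))
          (w⟶cyc⇒w⟶cyc[tp+] (suc q) s w⟶cycₛ)

      w⟶cyc : ∀ t → Arc D w (cyc (t + 2))
      w⟶cyc zero    = w⟶x₂
      w⟶cyc (suc t) = w⟶cyc⇒w⟶cyc[1+] (t + 2) (w⟶cyc t)

      w⟶x : ∀ {j} → j ≤ k → Arc D w (x j)
      w⟶x {j} j≤k = subst (Arc D w) cyc[j+K]≡xⱼ (w⟶cyc (j + p))
        where
          cyc[j+K]≡xⱼ : cyc (j + p + 2) ≡ x j
          cyc[j+K]≡xⱼ = trans (cong (λ i → x (i % K)) (trans (+-assoc j p 2) (cong (j +_) (+-comm p 2))))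
                              (trans (cong x ([m+n]%n≡m%n j K)) (cyc-≤ j≤k))

      module _ {y} (x₀⟶y : Arc D (x 0) y) (y≢x₁ : y ≢ x 1) where

        y≢x : ∀ {j} → j ≤ k + 2 → y ≢ x j
        y≢x {zero}        _   refl = loopless D (x 0) x₀⟶y
        y≢x {suc zero}    _        = y≢x₁
        y≢x {suc (suc j)} j≤  refl = noChord (s≤s (s≤s z≤n)) j≤ x₀⟶y

        cyc₃ : ℕ → Fin n
        cyc₃ t = cyc (t + 3)

        cyc₃-end : cyc₃ (q + q) ≡ x 0
        cyc₃-end = cong x (trans (cong (_% K) (+-comm (q + q) 3)) (n%n≡0 K))

        w∉cyc₃▹y : ∀ {t} → t ≤ suc (q + q) → w ≢ snoc cyc₃ (q + q) y t
        w∉cyc₃▹y {t} t≤ with m≤n⇒m<n∨m≡n t≤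
        ... | inj₁ (s≤s t≤q+q) rewrite snoc-≤ cyc₃ y t≤q+q = w≢cyc (t + 3)
        ... | inj₂ refl        rewrite snoc-suc cyc₃ (q + q) y = y≢x ≤-refl ∘ sym

        -- Quasi-transitivity along w, x₃, …, x_k, x₀, y.
        w⟶y : Arc D w y
        w⟶y with quasiTransitiveSeq qt
                   (prepend (append (cyc-window 3 (≤-trans (n≤1+n _) (n≤1+n _)))
                                    (subst (λ v → Arc D v y) (sym cyc₃-end) x₀⟶y)
                                    (λ {t} _ → y≢x (≤-trans (j%K≤k (t + 3)) k≤k+2) ∘ sym))
                            (subst (Arc D w) (sym (snoc-≤ cyc₃ {q + q} y z≤n)) (w⟶cyc 1))
                            w∉cyc₃▹y)
        ... | inj₁ w⟶ = subst (Arc D w) (snoc-suc cyc₃ (q + q) y) w⟶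
        ... | inj₂ ⟶w = ⊥-elim (noTwoPath x₀⟶y (subst (λ v → Arc D v w) (snoc-suc cyc₃ (q + q) y) ⟶w))

      w⟶N⁺x₀ : ∀ {y} → Arc D (x 0) y → Arc D w y
      w⟶N⁺x₀ {y} x₀⟶y with y ≟ x 1
      ... | yes refl = w⟶x (s≤s z≤n)
      ... | no  y≢x₁ = w⟶y x₀⟶y y≢x₁

      outDeg+k≤outDeg : outDeg D (x 0) + k ≤ outDeg D w
      outDeg+k≤outDeg =
        subst (λ l → outDeg D (x 0) + l ≤ outDeg D w) (cong suc (length-applyUpTo (λ t → x (2 + t)) p))
          (outDeg-dominated w⟶N⁺x₀ (x 0 ∷ applyUpTo (λ t → x (2 + t)) p)
            (applyUpTo⁺₁ _ p (λ t<p → injective π z<s (2+t≤k+2 t<p))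
              ∷ Unique.applyUpTo⁺₁ _ p (λ i<j j<p → injective π (s≤s (s≤s i<j)) (2+t≤k+2 j<p)))
            ((w⟶x z≤n , loopless D (x 0))
              ∷ applyUpTo⁺₁ _ p (λ t<p → w⟶x (s≤s t<p) , noChord (s≤s (s≤s z≤n)) (2+t≤k+2 t<p))))
        where
          2+t≤k+2 : ∀ {t} → t < p → 2 + t ≤ k + 2
          2+t≤k+2 t<p = ≤-trans (s≤s t<p) k≤k+2

2≤2*m⇒even : ∀ {k} m → 2 ≤ k → k ≡ 2 * m → Σ ℕ λ q → k ≡ suc (suc (q + q))
2≤2*m⇒even (suc q) _ refl = q , cong suc (trans (+-suc q (q + 0)) (cong (λ r → suc (q + r)) (+-identityʳ q)))

mainTheorem17 : (k : ℕ) → 2 ≤ k → (m : ℕ) → k ≡ 2 * m →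
    {n : ℕ} (D : Digraph n) → StronglyConnected D → QuasiTransitive D k →
    (v : Fin n) → outDeg D v ≤ maxOutDeg D → maxOutDeg D < outDeg D v + k →
    IsKing D (suc k) v
mainTheorem17 k 2≤k m k≡2m D sc qt v _ Δ<d⁺v+k with 2≤2*m⇒even m 2≤k k≡2m
... | q , refl = shortcuts⇒isKing D z<s sc λ {x} x₀≡v π noShortcut →
  <⇒≱ Δ<d⁺v+k
    (≤-trans (subst (λ a → outDeg D a + k ≤ _) x₀≡v (Domination.outDeg+k≤outDeg D q qt π noShortcut))
             (outDeg≤maxOutDeg D (x (k + 2))))
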